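{- If a mixed 3-separation of a 3-connected graph $G$ is not strong, then it is crossed by a trivial tri-separation of $G$.
   Context: Mixed 3-separation: ordered pair $(A,B)$ with $A\cup B=V(G)$, $A\setminus B,B\setminus A\neq\emptyset$, whose separator (disjoint union of $A\cap B$ and $E(A\setminus B,B\setminus A)$) has size three; strong if every vertex of $A\cap B$ has degree at least four. Tri-separation: mixed 3-separation in which every vertex of $A\cap B$ has at least two neighbours in $G[A]$ and in $G[B]$; trivial if $G[A]$ or $G[B]$ contains no cycle. $(A,B),(C,D)$ cross unless, after possibly swapping sides, $A\subseteq C$ and $B\supseteq D$. -}

module Defs where

open import Data.Nat using (ℕ; zero; suc; _+_; _≤_; _<_)
open import Data.Bool using (Bool; true; false; if_then_else_; _∧_; not)
open import Data.Fin using (Fin; zero; suc)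
open import Data.Fin.Subset using (Subset; _∈_; _∉_; _∩_; _∪_; _⊆_; ∁; ∣_∣)
open import Data.Vec using (lookup)
open import Data.List using (List; _∷_; []; _++_; length)
open import Data.List.Relation.Unary.All using (All)
open import Data.List.Relation.Unary.Linked using (Linked)
open import Data.List.Relation.Unary.Unique.Propositional using (Unique)
open import Data.Product using (Σ; _×_; ∃; ∃-syntax)
open import Data.Sum using (_⊎_)
open import Relation.Binary.PropositionalEquality using (_≡_)
open import Relation.Nullary using (¬_)

record Graph : Set where
  field
    n      : ℕ
    adj    : Fin n → Fin n → Bool
    sym    : ∀ u v → adj u v ≡ adj v u
    irrefl : ∀ u → adj u u ≡ false

open Graph public

count : ∀ {n} → (Fin n → Bool) → ℕ
count {zero}  f = 0
count {suc n} f = (if f zero then 1 else 0) + count (λ i → f (suc i))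

sumFin : ∀ {n} → (Fin n → ℕ) → ℕ
sumFin {zero}  f = 0
sumFin {suc n} f = f zero + sumFin (λ i → f (suc i))

module _ (G : Graph) where

  V = Fin (n G)
  VSet = Subset (n G)

  degree : V → ℕ
  degree x = count (adj G x)

  nbrsIn : VSet → V → ℕ
  nbrsIn S x = count (λ v → lookup S v ∧ adj G x v)

  data WalkIn (S : VSet) : V → V → Set where
    here : ∀ {u} → u ∈ S → WalkIn S u u
    step : ∀ {u w v} → u ∈ S → adj G u w ≡ true → WalkIn S w v → WalkIn S u v

  ConnectedIn : VSet → Set
  ConnectedIn S = ∀ u v → u ∈ S → v ∈ S → WalkIn S u v

  ThreeConnected : Set
  ThreeConnected = 3 < n G × (∀ (X : VSet) → ∣ X ∣ < 3 → ConnectedIn (∁ X))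

  inDiff : VSet → VSet → V → Bool
  inDiff S T u = lookup S u ∧ not (lookup T u)

  -- number of edges between A \ B and B \ A (these sets are disjoint, so each
  -- such edge is counted exactly once, as the pair (u , v) with u ∈ A \ B)
  crossEdges : VSet → VSet → ℕ
  crossEdges A B =
    sumFin (λ u → if inDiff A B u then count (λ v → inDiff B A v ∧ adj G u v) else 0)

  sepSize : VSet → VSet → ℕ
  sepSize A B = ∣ A ∩ B ∣ + crossEdges A B

  IsMixed3Sep : VSet → VSet → Set
  IsMixed3Sep A B =
    (∀ x → x ∈ A ∪ B)
    × (∃[ x ] (x ∈ A × x ∉ B))
    × (∃[ x ] (x ∈ B × x ∉ A))
    × sepSize A B ≡ 3

  IsStrong : VSet → VSet → Set
  IsStrong A B = ∀ x → x ∈ A ∩ B → 4 ≤ degree x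

  IsTriSep : VSet → VSet → Set
  IsTriSep A B =
    IsMixed3Sep A B
    × (∀ x → x ∈ A ∩ B → 2 ≤ nbrsIn A x × 2 ≤ nbrsIn B x)

  HasCycle : VSet → Set
  HasCycle S = Σ V λ v → Σ (List V) λ vs →
      3 ≤ length (v ∷ vs)
    × Unique (v ∷ vs)
    × All (_∈ S) (v ∷ vs)
    × Linked (λ a b → adj G a b ≡ true) ((v ∷ vs) ++ (v ∷ []))

  IsTrivialTriSep : VSet → VSet → Set
  IsTrivialTriSep A B = IsTriSep A B × (¬ HasCycle A ⊎ ¬ HasCycle B)

  -- (A , B) and (C , D) do not cross iff, after possibly swapping sides,
  -- A ⊆ C and B ⊇ D
  Nested : VSet → VSet → VSet → VSet → Set
  Nested A B C D =
      (A ⊆ C × D ⊆ B)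
    ⊎ (A ⊆ D × C ⊆ B)
    ⊎ (B ⊆ C × D ⊆ A)
    ⊎ (B ⊆ D × C ⊆ A)

  Cross : VSet → VSet → VSet → VSet → Set
  Cross A B C D = ¬ Nested A B C D

-- A vertex x of A ∩ B that witnesses non-strongness has degree at most 3, and
-- exactly 3 because a 3-connected graph has minimum degree 3 (deleting the
-- neighbours of a vertex of degree ≤ 2 would isolate it). The vertex cut
-- ({x} , V ∖ {x}) then has empty middle and exactly three cross edges, so it is
-- a tri-separation, trivial since G[{x}] has no cycle; it crosses (A , B)
-- because x lies on both sides of (A , B) while neither side is contained in
-- the other.
module Submission where

open import Defs hiding (sym)
open import Function using (_∘_)
open import Data.Bool using (Bool; true; false; if_then_else_; _∧_; not)
open import Data.Bool.Properties using (¬-not; ∧-zeroʳ) renaming (_≟_ to _≟ᵇ_)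
open import Data.Empty using (⊥-elim)
open import Data.Fin using (Fin; zero; suc; _≟_)
open import Data.Fin.Properties using (¬∀⟶∃¬; suc-injective)
open import Data.Fin.Subset using (Subset; _∈_; _∉_; _∩_; _∪_; ∁; ∣_∣; ⁅_⁆)
open import Data.Fin.Subset.Properties
  using (_∈?_; x∈⁅x⁆; x∈⁅y⁆⇒x≡y; x∈p⇒x∉∁p; x∉p⇒x∈∁p; x∈∁p⇒x∉p; x∈p∩q⁻; p∪∁p≡⊤; ∩-inverseʳ; ∈⊤; ∉⊥; ∣⊥∣≡0)
open import Data.List using ([]; _∷_)
open import Data.List.Relation.Unary.All using (_∷_)
open import Data.List.Relation.Unary.AllPairs using (_∷_)
open import Data.Nat using (ℕ; zero; suc; _+_; _≤_; _<_; s≤s; s≤s⁻¹; _≤?_)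
open import Data.Nat.Properties using (≤-refl; n≤1+n; ≤-trans; ≤-antisym; <⇒≱; ≰⇒>; +-identityʳ)
open import Data.Product using (Σ; ∃-syntax; _×_; _,_; proj₁; proj₂)
open import Data.Sum using (inj₁; inj₂)
open import Data.Vec using ([]; _∷_; lookup; tabulate)
open import Data.Vec.Properties using ([]=⇒lookup; lookup⇒[]=; lookup-map; lookup∘tabulate)
open import Relation.Binary.PropositionalEquality using (_≡_; _≢_; refl; sym; trans; cong; cong₂; subst; module ≡-Reasoning)
open import Relation.Nullary using (¬_; yes; no)
open import Relation.Nullary.Decidable using (¬?; _→-dec_)

private
  variable
    m : ℕ

lookup-∉ : {p : Subset m} {i : Fin m} → i ∉ p → lookup p i ≡ false
lookup-∉ {p = p} {i} i∉p = ¬-not (λ pi≡true → i∉p (lookup⇒[]= i p pi≡true))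

lookup-∁ : (p : Subset m) (i : Fin m) → lookup (∁ p) i ≡ not (lookup p i)
lookup-∁ p i = lookup-map i not p

∈-tabulate⁻ : {f : Fin m → Bool} {i : Fin m} → i ∈ tabulate f → f i ≡ true
∈-tabulate⁻ {f = f} {i} i∈ = trans (sym (lookup∘tabulate f i)) ([]=⇒lookup i∈)

∈-tabulate⁺ : {f : Fin m → Bool} {i : Fin m} → f i ≡ true → i ∈ tabulate f
∈-tabulate⁺ {f = f} {i} fi≡true = lookup⇒[]= i (tabulate f) (trans (lookup∘tabulate f i) fi≡true)

∉-tabulate⁺ : {f : Fin m → Bool} {i : Fin m} → f i ≡ false → i ∉ tabulate f
∉-tabulate⁺ fi≡false i∈ with () ← trans (sym (∈-tabulate⁻ i∈)) fi≡false

count-cong : {f g : Fin m → Bool} → (∀ i → f i ≡ g i) → count f ≡ count g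
count-cong {zero}  f≗g = refl
count-cong {suc m} f≗g =
  cong₂ _+_ (cong (λ b → if b then 1 else 0) (f≗g zero)) (count-cong (λ i → f≗g (suc i)))

count-all : {f : Fin m → Bool} → (∀ i → f i ≡ true) → count f ≡ m
count-all {zero}  all = refl
count-all {suc m} all rewrite all zero = cong suc (count-all (λ i → all (suc i)))

count-allBut : {f : Fin m → Bool} (x : Fin m) → (∀ i → i ≢ x → f i ≡ true) → m ≤ suc (count f)
count-allBut {suc m} {f} zero allBut
  rewrite count-all {f = λ i → f (suc i)} (λ i → allBut (suc i) λ ())
  with f zero
... | true  = s≤s (n≤1+n m)
... | false = ≤-refl
count-allBut {suc m} (suc x) allBut rewrite allBut zero λ () =
  s≤s (count-allBut x (λ i i≢x → allBut (suc i) (λ si≡sx → i≢x (suc-injective si≡sx))))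

count<⇒∃false : {f : Fin m → Bool} (x : Fin m) → suc (count f) < m →
  ∃[ i ] i ≢ x × f i ≡ false
count<⇒∃false {m} {f} x small with ¬∀⟶∃¬ m (λ i → i ≢ x → f i ≡ true)
  (λ i → ¬? (i ≟ x) →-dec (f i ≟ᵇ true))
  (λ allBut → <⇒≱ small (count-allBut x allBut))
... | i , ¬allBut =
  i , (λ i≡x → ¬allBut (λ i≢x → ⊥-elim (i≢x i≡x))) , ¬-not (λ fi → ¬allBut (λ _ → fi))

∣p∣≡count-lookup : (p : Subset m) → ∣ p ∣ ≡ count (lookup p)
∣p∣≡count-lookup []          = refl
∣p∣≡count-lookup (true ∷ p)  = cong suc (∣p∣≡count-lookup p)
∣p∣≡count-lookup (false ∷ p) = ∣p∣≡count-lookup p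

sumFin-cong : {f g : Fin m → ℕ} → (∀ i → f i ≡ g i) → sumFin f ≡ sumFin g
sumFin-cong {zero}  f≗g = refl
sumFin-cong {suc m} f≗g = cong₂ _+_ (f≗g zero) (sumFin-cong (λ i → f≗g (suc i)))

sumFin-zero : {f : Fin m → ℕ} → (∀ i → f i ≡ 0) → sumFin f ≡ 0
sumFin-zero {zero}  f≗0 = refl
sumFin-zero {suc m} f≗0 = cong₂ _+_ (f≗0 zero) (sumFin-zero (λ i → f≗0 (suc i)))

sumFin-supported : {f : Fin m → ℕ} (x : Fin m) → (∀ i → i ≢ x → f i ≡ 0) → sumFin f ≡ f x
sumFin-supported {suc m} {f} zero off =
  trans (cong (f zero +_) (sumFin-zero (λ i → off (suc i) λ ()))) (+-identityʳ (f zero))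
sumFin-supported {suc m} (suc x) off rewrite off zero λ () =
  sumFin-supported x (λ i i≢x → off (suc i) (λ si≡sx → i≢x (suc-injective si≡sx)))

∈p∪∁p : {i : Fin m} (p : Subset m) → i ∈ p ∪ ∁ p
∈p∪∁p p = subst (_ ∈_) (sym (p∪∁p≡⊤ p)) ∈⊤

module _ (G : Graph) where

  neighbours : V G → VSet G
  neighbours x = tabulate (adj G x)

  ∣neighbours∣≡degree : (x : V G) → ∣ neighbours x ∣ ≡ degree G x
  ∣neighbours∣≡degree x =
    trans (∣p∣≡count-lookup (neighbours x)) (count-cong (lookup∘tabulate (adj G x)))

  walkIn-head : {S : VSet G} {u v : V G} → WalkIn G S u v → u ∈ S
  walkIn-head (here u∈S)     = u∈S
  walkIn-head (step u∈S _ _) = u∈S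

  ¬walk-avoiding-neighbours : {x v : V G} → v ≢ x → ¬ WalkIn G (∁ (neighbours x)) x v
  ¬walk-avoiding-neighbours v≢x (here _)          = v≢x refl
  ¬walk-avoiding-neighbours v≢x (step _ x~w walk) =
    x∈∁p⇒x∉p (walkIn-head walk) (∈-tabulate⁺ x~w)

  ThreeConnected⇒3≤degree : ThreeConnected G → (x : V G) → 3 ≤ degree G x
  ThreeConnected⇒3≤degree (3<n , connected) x with 3 ≤? degree G x
  ... | yes 3≤deg = 3≤deg
  ... | no 3≰deg = ⊥-elim (isolated (count<⇒∃false x (≤-trans (s≤s (s≤s deg≤2)) 3<n)))
    where
      deg≤2 : degree G x ≤ 2
      deg≤2 = s≤s⁻¹ (≰⇒> 3≰deg)

      isolated : ¬ (∃[ v ] v ≢ x × adj G x v ≡ false)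
      isolated (v , v≢x , x≁v) = ¬walk-avoiding-neighbours v≢x
        (connected (neighbours x) (s≤s (subst (_≤ 2) (sym (∣neighbours∣≡degree x)) deg≤2))
          x v (x∉p⇒x∈∁p (∉-tabulate⁺ (irrefl G x))) (x∉p⇒x∈∁p (∉-tabulate⁺ x≁v)))

  inDiff-∁ʳ : (S : VSet G) (u : V G) → inDiff G S (∁ S) u ≡ lookup S u
  inDiff-∁ʳ S u rewrite lookup-∁ S u with lookup S u
  ... | true  = refl
  ... | false = refl

  inDiff-∁ˡ : (S : VSet G) (u : V G) → inDiff G (∁ S) S u ≡ not (lookup S u)
  inDiff-∁ˡ S u rewrite lookup-∁ S u with lookup S u
  ... | true  = refl
  ... | false = refl

  crossEdges-∁ : (S : VSet G) → crossEdges G S (∁ S) ≡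
    sumFin (λ u → if lookup S u then count (λ v → not (lookup S v) ∧ adj G u v) else 0)
  crossEdges-∁ S = sumFin-cong λ u →
    cong₂ (λ b k → if b then k else 0) (inDiff-∁ʳ S u)
      (count-cong λ v → cong (_∧ adj G u v) (inDiff-∁ˡ S v))

  crossEdges-⁅⁆ : (x : V G) → crossEdges G ⁅ x ⁆ (∁ ⁅ x ⁆) ≡ degree G x
  crossEdges-⁅⁆ x = begin
    crossEdges G ⁅ x ⁆ (∁ ⁅ x ⁆)
      ≡⟨ crossEdges-∁ ⁅ x ⁆ ⟩
    sumFin summand
      ≡⟨ sumFin-supported x (λ u u≢x →
           cong (λ b → if b then nbrsOutside u else 0) (lookup-∉ (u≢x ∘ x∈⁅y⁆⇒x≡y x))) ⟩
    summand x
      ≡⟨ cong (λ b → if b then nbrsOutside x else 0) ([]=⇒lookup (x∈⁅x⁆ x)) ⟩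
    nbrsOutside x
      ≡⟨ count-cong outside⁅x⁆∧adj ⟩
    degree G x ∎
    where
      open ≡-Reasoning

      nbrsOutside summand : V G → ℕ
      nbrsOutside u = count (λ v → not (lookup ⁅ x ⁆ v) ∧ adj G u v)
      summand u = if lookup ⁅ x ⁆ u then nbrsOutside u else 0

      outside⁅x⁆∧adj : ∀ v → not (lookup ⁅ x ⁆ v) ∧ adj G x v ≡ adj G x v
      outside⁅x⁆∧adj v with v ≟ x
      ... | yes refl = trans (cong (_ ∧_) (irrefl G x)) (trans (∧-zeroʳ _) (sym (irrefl G x)))
      ... | no v≢x rewrite lookup-∉ (v≢x ∘ x∈⁅y⁆⇒x≡y x) = refl

  ∁-isTriSep : (S : VSet G) {x y : V G} → x ∈ S → y ∉ S → crossEdges G S (∁ S) ≡ 3 →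
    IsTriSep G S (∁ S)
  ∁-isTriSep S {x} {y} x∈S y∉S three =
    ( (λ u → ∈p∪∁p S)
    , (x , x∈S , x∈p⇒x∉∁p x∈S)
    , (y , x∉p⇒x∈∁p y∉S , y∉S)
    , trans (cong (_+ crossEdges G S (∁ S)) noMiddle) three )
    , λ u u∈S∩∁S → ⊥-elim (∉⊥ (subst (u ∈_) (∩-inverseʳ S) u∈S∩∁S))
    where
      noMiddle : ∣ S ∩ ∁ S ∣ ≡ 0
      noMiddle = trans (cong ∣_∣ (∩-inverseʳ S)) (∣⊥∣≡0 (n G))

  ¬HasCycle-⁅⁆ : (x : V G) → ¬ HasCycle G ⁅ x ⁆
  ¬HasCycle-⁅⁆ x (v , []     , s≤s () , _)
  ¬HasCycle-⁅⁆ x (v , w ∷ ws , _ , ((v≢w ∷ _) ∷ _) , (v∈⁅x⁆ ∷ w∈⁅x⁆ ∷ _) , _) =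
    v≢w (trans (x∈⁅y⁆⇒x≡y x v∈⁅x⁆) (sym (x∈⁅y⁆⇒x≡y x w∈⁅x⁆)))

  vertexCut-isTrivialTriSep : {x y : V G} → y ≢ x → degree G x ≡ 3 →
    IsTrivialTriSep G ⁅ x ⁆ (∁ ⁅ x ⁆)
  vertexCut-isTrivialTriSep {x} y≢x deg≡3 =
    ∁-isTriSep ⁅ x ⁆ (x∈⁅x⁆ x) (y≢x ∘ x∈⁅y⁆⇒x≡y x) (trans (crossEdges-⁅⁆ x) deg≡3)
    , inj₁ (¬HasCycle-⁅⁆ x)

  vertexCut-crosses : {A B : VSet G} {x a b : V G} → x ∈ A → x ∈ B →
    a ∈ A → a ∉ B → b ∈ B → b ∉ A → Cross G A B ⁅ x ⁆ (∁ ⁅ x ⁆)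
  vertexCut-crosses {x = x} x∈A x∈B a∈A a∉B b∈B b∉A = λ
    { (inj₁ (A⊆⁅x⁆ , _))               → a∉B (subst (_∈ _) (sym (x∈⁅y⁆⇒x≡y x (A⊆⁅x⁆ a∈A))) x∈B)
    ; (inj₂ (inj₁ (A⊆∁⁅x⁆ , _)))        → x∈∁p⇒x∉p (A⊆∁⁅x⁆ x∈A) (x∈⁅x⁆ x)
    ; (inj₂ (inj₂ (inj₁ (B⊆⁅x⁆ , _))))  → b∉A (subst (_∈ _) (sym (x∈⁅y⁆⇒x≡y x (B⊆⁅x⁆ b∈B))) x∈A)
    ; (inj₂ (inj₂ (inj₂ (B⊆∁⁅x⁆ , _)))) → x∈∁p⇒x∉p (B⊆∁⁅x⁆ x∈B) (x∈⁅x⁆ x)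
    }

  ¬IsStrong⇒∃degree<4 : {A B : VSet G} → ¬ IsStrong G A B →
    ∃[ x ] x ∈ A ∩ B × degree G x < 4
  ¬IsStrong⇒∃degree<4 {A} {B} notStrong
    with ¬∀⟶∃¬ (n G) (λ x → x ∈ A ∩ B → 4 ≤ degree G x)
           (λ x → (x ∈? A ∩ B) →-dec (4 ≤? degree G x)) notStrong
  ... | x , ¬strongAt-x with x ∈? A ∩ B
  ...   | yes x∈A∩B = x , x∈A∩B , ≰⇒> (λ 4≤deg → ¬strongAt-x (λ _ → 4≤deg))
  ...   | no  x∉A∩B = ⊥-elim (¬strongAt-x (⊥-elim ∘ x∉A∩B))

mainTheorem13 : (G : Graph) → ThreeConnected G →
    (A B : VSet G) → IsMixed3Sep G A B → ¬ IsStrong G A B →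
    Σ (VSet G) λ C → Σ (VSet G) λ D →
      IsTrivialTriSep G C D × Cross G A B C D
mainTheorem13 G connected A B (_ , (a , a∈A , a∉B) , (b , b∈B , b∉A) , _) notStrong
  with ¬IsStrong⇒∃degree<4 G notStrong
... | x , x∈A∩B , deg<4 =
  ⁅ x ⁆ , ∁ ⁅ x ⁆ ,
  vertexCut-isTrivialTriSep G a≢x deg≡3 ,
  vertexCut-crosses G x∈A x∈B a∈A a∉B b∈B b∉A
  where
    x∈A : x ∈ A
    x∈A = proj₁ (x∈p∩q⁻ A B x∈A∩B)

    x∈B : x ∈ B
    x∈B = proj₂ (x∈p∩q⁻ A B x∈A∩B)

    a≢x : a ≢ x
    a≢x a≡x = a∉B (subst (_∈ B) (sym a≡x) x∈B)

    deg≡3 : degree G x ≡ 3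
    deg≡3 = ≤-antisym (s≤s⁻¹ deg<4) (ThreeConnected⇒3≤degree G connected x)
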